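{- Let $\mathcal{P}\subseteq 2^{\mathbb{N}}$ be a non-empty clopen set. Then every weakly (Kurtz) random sequence $Z\in 2^{\mathbb{N}}$ is multiply recurrent in $\mathcal{P}$, i.e. for every $k\ge 1$ there is $n\ge 1$ such that $T^{ni}(Z)\in\mathcal{P}$ for all $i$ with $1\le i\le k$.
   Context: $T:2^{\mathbb{N}}\to 2^{\mathbb{N}}$ is the shift operator, deleting the first bit of a sequence; so $T^{m}(Z)$ is the tail of $Z$ starting at bit position $m$. For closed $\mathcal{P}$ and $k\ge1$, $Z$ is $k$-recurrent in $\mathcal{P}$ if there is $n\ge1$ with $Z\in\bigcap_{1\le i\le k}T^{ -ni}(\mathcal{P})$, and multiply recurrent in $\mathcal{P}$ if it is $k$-recurrent for every $k\ge 1$. $Z$ is weakly (Kurtz) random if $Z$ belongs to no Lebesgue-null $\Pi^0_1$ class. -}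

module Defs where

open import Data.Nat using (ℕ; zero; suc; _+_; _*_; _^_; _≤_)
open import Data.Fin using (Fin; toℕ)
open import Data.Bool using (Bool; true; false; _∧_)
open import Data.List using (List; []; _∷_; length; filter; take; map; upTo; concatMap)
open import Data.Bool.ListAction using (and)
open import Data.Bool.Properties using (T?)
open import Data.Bool using (not; T)
open import Data.Vec using (Vec; []; _∷_; lookup; tabulate)
open import Data.Product using (Σ; _×_)
open import Relation.Binary.PropositionalEquality using (_≡_)
open import Relation.Nullary.Decidable using (⌊_⌋)
import Data.Nat as ℕ

Seq : Set
Seq = ℕ → Bool

shift : ℕ → Seq → Seq
shift m Z i = Z (m + i)

prefix : Seq → ℕ → List Bool
prefix Z zero    = []
prefix Z (suc m) = Z 0 ∷ prefix (λ i → Z (suc i)) m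

-- Clopen subsets of 2^ℕ: every clopen set is determined by the first
-- `depth` bits, i.e. is a finite union of cylinders [σ], |σ| = depth.

record Clopen : Set where
  field
    depth  : ℕ
    decide : Vec Bool depth → Bool
open Clopen public

_∈C_ : Seq → Clopen → Set
Z ∈C P = decide P (tabulate (λ i → Z (toℕ i))) ≡ true

NonEmpty : Clopen → Set
NonEmpty P = Σ Seq λ Z → Z ∈C P

kRecurrentAt : Clopen → ℕ → Seq → ℕ → Set
kRecurrentAt P k Z n = (i : ℕ) → 1 ≤ i → i ≤ k → shift (n * i) Z ∈C P

kRecurrent : Clopen → ℕ → Seq → Set
kRecurrent P k Z = Σ ℕ λ n → 1 ≤ n × kRecurrentAt P k Z n

MultiplyRecurrent : Clopen → Seq → Set
MultiplyRecurrent P Z = (k : ℕ) → 1 ≤ k → kRecurrent P k Z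

data PR : ℕ → Set where
  zeroF : ∀ {n} → PR n
  succF : PR 1
  proj  : ∀ {n} → Fin n → PR n
  comp  : ∀ {n m} → PR m → Vec (PR n) m → PR n
  prec  : ∀ {n} → PR n → PR (suc (suc n)) → PR (suc n)

mutual
  eval : ∀ {n} → PR n → Vec ℕ n → ℕ
  eval zeroF      xs            = 0
  eval succF      (x ∷ [])      = suc x
  eval (proj i)   xs            = lookup xs i
  eval (comp f gs) xs           = eval f (evalVec gs xs)
  eval (prec f g) (zero ∷ xs)   = eval f xs
  eval (prec f g) (suc y ∷ xs)  = eval g (y ∷ eval (prec f g) (y ∷ xs) ∷ xs)

  evalVec : ∀ {n m} → Vec (PR n) m → Vec ℕ n → Vec ℕ m
  evalVec []       xs = []
  evalVec (g ∷ gs) xs = eval g xs ∷ evalVec gs xs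

code : List Bool → ℕ
code []          = 0
code (false ∷ s) = 1 + 2 * code s
code (true ∷ s)  = 2 + 2 * code s

-- Π⁰₁ classes: a primitive recursive predicate R on strings (R σ holds
-- iff eval R [code σ] ≠ 0) presents the Π⁰₁ class
--   [R] = { Z | ∀ m, R (Z ↾ m) }.

holds : PR 1 → List Bool → Bool
holds R σ = not ⌊ eval R (code σ ∷ []) ℕ.≟ 0 ⌋

survives : PR 1 → List Bool → Bool
survives R σ = and (map (λ m → holds R (take m σ)) (upTo (suc (length σ))))

strings : ℕ → List (List Bool)
strings zero    = [] ∷ []
strings (suc n) = concatMap (λ s → (false ∷ s) ∷ (true ∷ s) ∷ []) (strings n)

count : PR 1 → ℕ → ℕ
count R n = length (filter (λ σ → T? (survives R σ)) (strings n))

-- Lebesgue measure of [R] is 0:  μ[R] = lim_n count R n / 2^n = 0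
Null : PR 1 → Set
Null R = (k : ℕ) → Σ ℕ λ n → count R n * 2 ^ k ≤ 2 ^ n

-- Z ∉ [R], stated positively: Z leaves R at some finite level
NotIn : Seq → PR 1 → Set
NotIn Z R = Σ ℕ λ m → eval R (code (prefix Z m) ∷ []) ≡ 0

KurtzRandom : Seq → Set
KurtzRandom Z = (R : PR 1) → Null R → NotIn Z R

module Submission where

-- P is decided by its first d bits; fix a point W ∈ P and its pattern
-- w = W ↾ d (if d = 0, P is everything and n = 1 works).  Given k ≥ 1, use
-- the scales n_j = d·(k+1)^j and call j a hit of Z when Z shows w right
-- after each position n_j·i, 1 ≤ i ≤ k; a hit makes Z k-recurrent with
-- n = n_j.  The sequences without hits form a Π⁰₁ class, presented by a
-- primitive recursive test which, on a string σ, multiplies over j < code σ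
-- a quantity vanishing exactly at the hits visible in σ.  The k blocks of
-- scale j lie in [n_j, n_{j+1}), so different scales are independent, and
-- the strings of length n_J missing every scale below J are a fraction
-- (1 - 2^(-kd))^J of all strings; for J = 2^(kd)·K this is at most 2^(-K),
-- so the class is null.  Being Kurtz random, Z leaves it: Z has a hit.

open import Defs
open import Data.Nat using (ℕ; zero; suc; _+_; _*_; _∸_; _^_; _≤_; _<_; z≤n; s≤s; pred)
import Data.Nat as ℕ
open import Data.Nat.Properties
open import Data.Nat.Tactic.RingSolver using (solve-∀)
open import Data.Fin using (Fin; toℕ; fromℕ<) renaming (zero to fz; suc to fs)
open import Data.Fin.Properties using (toℕ-fromℕ<)
open import Data.Vec using (Vec; []; _∷_)
open import Data.Vec.Properties using (tabulate-cong)
open import Data.List using (List; []; _∷_; drop; take; length; map; applyUpTo; filter; concatMap)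
open import Data.List.Properties using (drop-drop; take-all)
open import Data.Bool using (Bool; true; false; _∧_; not)
open import Data.Bool.Properties using (T?; ¬-not)
open import Data.Bool.ListAction using (and)
open import Data.Product using (Σ; _×_; _,_; proj₁; proj₂)
open import Data.Sum using (inj₁; inj₂)
open import Data.Empty using (⊥-elim)
open import Relation.Nullary using (¬_)
open import Relation.Nullary.Decidable using (⌊_⌋)
open import Relation.Binary.PropositionalEquality hiding (J)

lit : ∀ {n} → ℕ → PR n
lit zero    = zeroF
lit (suc c) = comp succF (lit c ∷ [])

eval-lit : ∀ {n} c (xs : Vec ℕ n) → eval (lit c) xs ≡ c
eval-lit zero    xs = refl
eval-lit (suc c) xs = cong suc (eval-lit c xs)

π₀ : ∀ {n} → PR (suc n)
π₀ = proj fz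

π₁ : ∀ {n} → PR (suc (suc n))
π₁ = proj (fs fz)

π₂ : ∀ {n} → PR (suc (suc (suc n)))
π₂ = proj (fs (fs fz))

-- On arguments (y , x): addition y + x, multiplication y * x, and
-- truncated subtraction x ∸ y.

addPR : PR 2
addPR = prec π₀ (comp succF (π₁ ∷ []))

eval-add : ∀ y x → eval addPR (y ∷ x ∷ []) ≡ y + x
eval-add zero    x = refl
eval-add (suc y) x = cong suc (eval-add y x)

mulPR : PR 2
mulPR = prec zeroF (comp addPR (π₁ ∷ π₂ ∷ []))

eval-mul : ∀ y x → eval mulPR (y ∷ x ∷ []) ≡ y * x
eval-mul zero    x = refl
eval-mul (suc y) x = begin
    eval addPR (eval mulPR (y ∷ x ∷ []) ∷ x ∷ [])
  ≡⟨ eval-add _ x ⟩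
    eval mulPR (y ∷ x ∷ []) + x
  ≡⟨ cong (_+ x) (eval-mul y x) ⟩
    y * x + x
  ≡⟨ +-comm (y * x) x ⟩
    x + y * x
  ∎
  where open ≡-Reasoning

predPR : PR 1
predPR = prec zeroF π₀

eval-pred : ∀ y → eval predPR (y ∷ []) ≡ pred y
eval-pred zero    = refl
eval-pred (suc y) = refl

monusPR : PR 2
monusPR = prec π₀ (comp predPR (π₁ ∷ []))

eval-monus : ∀ y x → eval monusPR (y ∷ x ∷ []) ≡ x ∸ y
eval-monus zero    x = refl
eval-monus (suc y) x = trans (eval-pred (eval monusPR (y ∷ x ∷ [])))
                             (trans (cong pred (eval-monus y x)) (pred[m∸n]≡m∸[1+n] x y))

infixl 6 _⊕_ _⊖_
infixl 7 _⊗_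

_⊕_ _⊗_ _⊖_ : ∀ {n} → PR n → PR n → PR n
a ⊕ b = comp addPR (a ∷ b ∷ [])
a ⊗ b = comp mulPR (a ∷ b ∷ [])
a ⊖ b = comp monusPR (b ∷ a ∷ [])

module _ {n} (a b : PR n) (xs : Vec ℕ n) where

  eval-⊕ : eval (a ⊕ b) xs ≡ eval a xs + eval b xs
  eval-⊕ = eval-add (eval a xs) (eval b xs)

  eval-⊗ : eval (a ⊗ b) xs ≡ eval a xs * eval b xs
  eval-⊗ = eval-mul (eval a xs) (eval b xs)

  eval-⊖ : eval (a ⊖ b) xs ≡ eval a xs ∸ eval b xs
  eval-⊖ = eval-monus (eval b xs) (eval a xs)

powPR : ℕ → PR 1
powPR b = prec (lit 1) (lit b ⊗ π₁)

eval-pow : ∀ b y → eval (powPR b) (y ∷ []) ≡ b ^ y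
eval-pow b zero    = refl
eval-pow b (suc y) = trans (eval-⊗ (lit b) π₁ (y ∷ eval (powPR b) (y ∷ []) ∷ []))
                           (cong₂ _*_ (eval-lit b _) (eval-pow b y))

-- Decoding strings from their codes.  code (b ∷ s) is 1 + 2·code s or
-- 2 + 2·code s, so the tail of a string is coded by ⌊(c - 1)/2⌋ and its
-- first bit by c - 2·code (tail).  Halving is computed by primitive
-- recursion together with the parity.

parityPR : PR 1
parityPR = prec zeroF (lit 1 ⊖ π₁)

halfPR : PR 1
halfPR = prec zeroF (π₁ ⊕ comp parityPR (π₀ ∷ []))

parity half : ℕ → ℕ
parity y = eval parityPR (y ∷ [])
half   y = eval halfPR (y ∷ [])

parity-suc : ∀ y → parity (suc y) ≡ 1 ∸ parity y
parity-suc y = trans (eval-⊖ (lit 1) π₁ (y ∷ parity y ∷ [])) (cong (_∸ parity y) (eval-lit 1 (y ∷ parity y ∷ [])))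

half-suc : ∀ y → half (suc y) ≡ half y + parity y
half-suc y = eval-⊕ π₁ (comp parityPR (π₀ ∷ [])) (y ∷ half y ∷ [])

-- Halves y c says y = 2c, as read off by parity and half at y and y + 1.
Halves : ℕ → ℕ → Set
Halves y c = (parity y ≡ 0 × parity (suc y) ≡ 1) × (half y ≡ c × half (suc y) ≡ c)

halves-step : ∀ {y c} → Halves y c → Halves (suc (suc y)) (suc c)
halves-step {y} {c} ((even , odd) , (h₀ , h₁)) = (even′ , odd′) , (h₀′ , h₁′)
  where
  even′ : parity (suc (suc y)) ≡ 0
  even′ = trans (parity-suc (suc y)) (cong (1 ∸_) odd)
  odd′ : parity (suc (suc (suc y))) ≡ 1
  odd′ = trans (parity-suc (suc (suc y))) (cong (1 ∸_) even′)
  h₀′ : half (suc (suc y)) ≡ suc c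
  h₀′ = trans (half-suc (suc y)) (trans (cong₂ _+_ h₁ odd) (+-comm c 1))
  h₁′ : half (suc (suc (suc y))) ≡ suc c
  h₁′ = trans (half-suc (suc (suc y))) (trans (cong₂ _+_ h₀′ even′) (+-identityʳ (suc c)))

halving : ∀ c → Halves (2 * c) c
halving zero    = (refl , refl) , (refl , refl)
halving (suc c) = subst (λ y → Halves y (suc c)) (sym (*-suc 2 c)) (halves-step {2 * c} (halving c))

tailPR : PR 1
tailPR = comp halfPR (comp predPR (π₀ ∷ []) ∷ [])

eval-tail : ∀ s → eval tailPR (code s ∷ []) ≡ code (drop 1 s)
eval-tail []          = refl
eval-tail (false ∷ s) = proj₁ (proj₂ (halving (code s)))
eval-tail (true ∷ s)  = proj₂ (proj₂ (halving (code s)))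

bitCode : Bool → ℕ
bitCode false = 1
bitCode true  = 2

headCode : List Bool → ℕ
headCode []      = 0
headCode (b ∷ _) = bitCode b

headPR : PR 1
headPR = π₀ ⊖ lit 2 ⊗ tailPR

eval-head : ∀ s → eval headPR (code s ∷ []) ≡ headCode s
eval-head s = begin
    eval headPR (code s ∷ [])
  ≡⟨ eval-⊖ π₀ (lit 2 ⊗ tailPR) (code s ∷ []) ⟩
    code s ∸ eval (lit 2 ⊗ tailPR) (code s ∷ [])
  ≡⟨ cong (code s ∸_) (trans (eval-⊗ (lit 2) tailPR (code s ∷ []))
                             (cong₂ _*_ (eval-lit 2 (code s ∷ [])) (eval-tail s))) ⟩
    code s ∸ 2 * code (drop 1 s)
  ≡⟨ strip s ⟩
    headCode s
  ∎
  where
  open ≡-Reasoning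
  strip : ∀ s → code s ∸ 2 * code (drop 1 s) ≡ headCode s
  strip []          = refl
  strip (false ∷ s) = m+n∸n≡m 1 (2 * code s)
  strip (true ∷ s)  = m+n∸n≡m 2 (2 * code s)

dropPR : PR 2
dropPR = prec π₀ (comp tailPR (π₁ ∷ []))

eval-drop : ∀ p s → eval dropPR (p ∷ code s ∷ []) ≡ code (drop p s)
eval-drop zero    s = refl
eval-drop (suc p) s = begin
    eval tailPR (eval dropPR (p ∷ code s ∷ []) ∷ [])
  ≡⟨ cong (λ c → eval tailPR (c ∷ [])) (eval-drop p s) ⟩
    eval tailPR (code (drop p s) ∷ [])
  ≡⟨ eval-tail (drop p s) ⟩
    code (drop 1 (drop p s))
  ≡⟨ cong code (trans (drop-drop p 1 s) (cong (λ m → drop m s) (+-comm p 1))) ⟩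
    code (drop (suc p) s)
  ∎
  where open ≡-Reasoning

digit : List Bool → ℕ → ℕ
digit s p = headCode (drop p s)

digitPR : PR 2
digitPR = comp headPR (dropPR ∷ [])

eval-digit : ∀ p s → eval digitPR (p ∷ code s ∷ []) ≡ digit s p
eval-digit p s = trans (cong (λ c → eval headPR (c ∷ [])) (eval-drop p s)) (eval-head (drop p s))

-- The distance |a - b| vanishes exactly when a = b; a finite sum
-- vanishes exactly when every summand does; a bounded product
-- ∏_{j<y} f (j , c) vanishes exactly when f (j , c) does for some j < y.

distPR : ∀ {n} → PR n → PR n → PR n
distPR a b = (a ⊖ b) ⊕ (b ⊖ a)

eval-dist : ∀ {n} (a b : PR n) xs → eval (distPR a b) xs ≡ (eval a xs ∸ eval b xs) + (eval b xs ∸ eval a xs)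
eval-dist a b xs = trans (eval-⊕ (a ⊖ b) (b ⊖ a) xs) (cong₂ _+_ (eval-⊖ a b xs) (eval-⊖ b a xs))

monus-sym≡0⇒≡ : ∀ x y → (x ∸ y) + (y ∸ x) ≡ 0 → x ≡ y
monus-sym≡0⇒≡ zero    zero    _ = refl
monus-sym≡0⇒≡ (suc x) (suc y) e = cong suc (monus-sym≡0⇒≡ x y e)

dist≡0⇒ : ∀ {n} (a b : PR n) xs → eval (distPR a b) xs ≡ 0 → eval a xs ≡ eval b xs
dist≡0⇒ a b xs e = monus-sym≡0⇒≡ _ _ (trans (sym (eval-dist a b xs)) e)

⇒dist≡0 : ∀ {n} (a b : PR n) xs → eval a xs ≡ eval b xs → eval (distPR a b) xs ≡ 0
⇒dist≡0 a b xs e = begin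
    eval (distPR a b) xs
  ≡⟨ eval-dist a b xs ⟩
    (eval a xs ∸ eval b xs) + (eval b xs ∸ eval a xs)
  ≡⟨ cong₂ _+_ (cong (_∸ eval b xs) e) (cong (eval b xs ∸_) e) ⟩
    (eval b xs ∸ eval b xs) + (eval b xs ∸ eval b xs)
  ≡⟨ cong₂ _+_ (n∸n≡0 (eval b xs)) (n∸n≡0 (eval b xs)) ⟩
    0
  ∎
  where open ≡-Reasoning

sumPR : ∀ {n} m → (Fin m → PR n) → PR n
sumPR zero    f = zeroF
sumPR (suc m) f = f fz ⊕ sumPR m (λ i → f (fs i))

sum≡0⇒ : ∀ {n} m (f : Fin m → PR n) xs → eval (sumPR m f) xs ≡ 0 → ∀ i → eval (f i) xs ≡ 0
sum≡0⇒ (suc m) f xs e i = summands i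
  where
  e′ : eval (f fz) xs + eval (sumPR m (λ i → f (fs i))) xs ≡ 0
  e′ = trans (sym (eval-⊕ (f fz) (sumPR m (λ i → f (fs i))) xs)) e
  summands : ∀ i → eval (f i) xs ≡ 0
  summands fz     = m+n≡0⇒m≡0 _ e′
  summands (fs i) = sum≡0⇒ m (λ i → f (fs i)) xs (m+n≡0⇒n≡0 _ e′) i

⇒sum≡0 : ∀ {n} m (f : Fin m → PR n) xs → (∀ i → eval (f i) xs ≡ 0) → eval (sumPR m f) xs ≡ 0
⇒sum≡0 zero    f xs h = refl
⇒sum≡0 (suc m) f xs h = trans (eval-⊕ (f fz) (sumPR m (λ i → f (fs i))) xs)
                              (cong₂ _+_ (h fz) (⇒sum≡0 m (λ i → f (fs i)) xs (λ i → h (fs i))))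

prodBelowPR : PR 2 → PR 2
prodBelowPR f = prec (lit 1) (π₁ ⊗ comp f (π₀ ∷ π₂ ∷ []))

module _ (f : PR 2) where

  prod : ℕ → ℕ → ℕ
  prod y c = eval (prodBelowPR f) (y ∷ c ∷ [])

  prod-suc : ∀ y c → prod (suc y) c ≡ prod y c * eval f (y ∷ c ∷ [])
  prod-suc y c = eval-⊗ π₁ (comp f (π₀ ∷ π₂ ∷ [])) (y ∷ prod y c ∷ c ∷ [])

  prodBelow≡0⇒ : ∀ y c → prod y c ≡ 0 → Σ ℕ λ j → j < y × eval f (j ∷ c ∷ []) ≡ 0
  prodBelow≡0⇒ (suc y) c e with m*n≡0⇒m≡0∨n≡0 (prod y c) (trans (sym (prod-suc y c)) e)
  ... | inj₁ earlier = let (j , j<y , fj≡0) = prodBelow≡0⇒ y c earlier in j , m<n⇒m<1+n j<y , fj≡0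
  ... | inj₂ last    = y , ≤-refl , last

  ⇒prodBelow≡0 : ∀ y c j → j < y → eval f (j ∷ c ∷ []) ≡ 0 → prod y c ≡ 0
  ⇒prodBelow≡0 (suc y) c j (s≤s j≤y) fj≡0 with m≤n⇒m<n∨m≡n j≤y
  ... | inj₁ j<y  = trans (prod-suc y c) (cong (_* eval f (y ∷ c ∷ [])) (⇒prodBelow≡0 y c j j<y fj≡0))
  ... | inj₂ refl = trans (prod-suc y c) (trans (cong (prod y c *_) fj≡0) (*-zeroʳ (prod y c)))

∧-true : ∀ {a b} → a ∧ b ≡ true → a ≡ true × b ≡ true
∧-true {true} {true} _ = refl , refl

bitCode≢0 : ∀ b → bitCode b ≢ 0
bitCode≢0 false ()
bitCode≢0 true  ()

bitCode-injective : ∀ a b → bitCode a ≡ bitCode b → a ≡ b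
bitCode-injective false false _ = refl
bitCode-injective true  true  _ = refl

digit-[] : ∀ p → digit [] p ≡ 0
digit-[] zero    = refl
digit-[] (suc p) = refl

digit-take : ∀ n s p b → digit (take n s) p ≡ bitCode b → digit s p ≡ bitCode b
digit-take zero    s       p       b e = ⊥-elim (bitCode≢0 b (trans (sym e) (digit-[] p)))
digit-take (suc n) []      p       b e = e
digit-take (suc n) (x ∷ s) zero    b e = e
digit-take (suc n) (x ∷ s) (suc p) b e = digit-take n s p b e

digit-drop : ∀ a s p → digit (drop a s) p ≡ digit s (a + p)
digit-drop a s p = cong headCode (drop-drop a p s)

digit≢0⇒< : ∀ s p → digit s p ≢ 0 → p < length s
digit≢0⇒< []      p       nz = ⊥-elim (nz (digit-[] p))
digit≢0⇒< (x ∷ s) zero    nz = s≤s z≤n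
digit≢0⇒< (x ∷ s) (suc p) nz = s≤s (digit≢0⇒< s p nz)

length≤code : ∀ s → length s ≤ code s
length≤code []          = z≤n
length≤code (false ∷ s) = s≤s (≤-trans (length≤code s) (m≤m+n (code s) _))
length≤code (true ∷ s)  = s≤s (≤-trans (length≤code s) (≤-trans (m≤m+n (code s) _) (n≤1+n _)))

digit-prefix : ∀ Z m p b → digit (prefix Z m) p ≡ bitCode b → Z p ≡ b
digit-prefix Z zero    p       b e = ⊥-elim (bitCode≢0 b (trans (sym e) (digit-[] p)))
digit-prefix Z (suc m) zero    b e = bitCode-injective _ _ e
digit-prefix Z (suc m) (suc p) b e = digit-prefix (λ i → Z (suc i)) m p b e

survives⇒≢0 : ∀ R s → survives R s ≡ true → eval R (code s ∷ []) ≢ 0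
survives⇒≢0 R s e = holds⇒≢0 (eval R (code s ∷ []))
  (subst (λ σ → holds R σ ≡ true) (take-all (length s) s ≤-refl)
         (and-last (λ m → holds R (take m s)) (λ x → x) (length s) e))
  where
  and-last : ∀ (f : ℕ → Bool) g n → and (map f (applyUpTo g (suc n))) ≡ true → f (g n) ≡ true
  and-last f g zero    e = proj₁ (∧-true e)
  and-last f g (suc n) e = and-last f (λ x → g (suc x)) n (proj₂ (∧-true {f (g 0)} e))
  holds⇒≢0 : ∀ n → not ⌊ n ℕ.≟ 0 ⌋ ≡ true → n ≢ 0
  holds⇒≢0 (suc n) _ ()

-- Counting strings.  tally L f is the number of strings of length L
-- passing the test f, i.e. 2^L times the measure of the clopen set it
-- defines.

countIn : (List Bool → Bool) → List (List Bool) → ℕ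
countIn f xs = length (filter (λ σ → T? (f σ)) xs)

tally : ℕ → (List Bool → Bool) → ℕ
tally L f = countIn f (strings L)

indicator : Bool → ℕ
indicator true  = 1
indicator false = 0

countIn-∷ : ∀ f x xs → countIn f (x ∷ xs) ≡ indicator (f x) + countIn f xs
countIn-∷ f x xs with f x
... | true  = refl
... | false = refl

countIn-mono : ∀ f g xs → (∀ s → f s ≡ true → g s ≡ true) → countIn f xs ≤ countIn g xs
countIn-mono f g []       f⇒g = z≤n
countIn-mono f g (x ∷ xs) f⇒g = subst₂ _≤_ (sym (countIn-∷ f x xs)) (sym (countIn-∷ g x xs))
  (+-mono-≤ (indicator-mono (f x) (g x) (f⇒g x)) (countIn-mono f g xs f⇒g))
  where
  indicator-mono : ∀ a b → (a ≡ true → b ≡ true) → indicator a ≤ indicator b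
  indicator-mono false b  _   = z≤n
  indicator-mono true  b a⇒b rewrite a⇒b refl = ≤-refl

countIn-false : ∀ xs → countIn (λ _ → false) xs ≡ 0
countIn-false []       = refl
countIn-false (x ∷ xs) = countIn-false xs

tally-suc : ∀ L f → tally (suc L) f ≡ tally L (λ s → f (false ∷ s)) + tally L (λ s → f (true ∷ s))
tally-suc L f = split (strings L)
  where
  f₀ f₁ : List Bool → Bool
  f₀ s = f (false ∷ s)
  f₁ s = f (true ∷ s)
  interleave : ∀ a b A B → a + (b + (A + B)) ≡ (a + A) + (b + B)
  interleave = solve-∀
  split : ∀ xs → countIn f (concatMap (λ s → (false ∷ s) ∷ (true ∷ s) ∷ []) xs) ≡ countIn f₀ xs + countIn f₁ xs
  split []       = refl
  split (x ∷ xs) = begin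
      countIn f ((false ∷ x) ∷ (true ∷ x) ∷ rest)
    ≡⟨ countIn-∷ f (false ∷ x) ((true ∷ x) ∷ rest) ⟩
      indicator (f₀ x) + countIn f ((true ∷ x) ∷ rest)
    ≡⟨ cong (indicator (f₀ x) +_) (countIn-∷ f (true ∷ x) rest) ⟩
      indicator (f₀ x) + (indicator (f₁ x) + countIn f rest)
    ≡⟨ cong (λ n → indicator (f₀ x) + (indicator (f₁ x) + n)) (split xs) ⟩
      indicator (f₀ x) + (indicator (f₁ x) + (countIn f₀ xs + countIn f₁ xs))
    ≡⟨ interleave (indicator (f₀ x)) (indicator (f₁ x)) (countIn f₀ xs) (countIn f₁ xs) ⟩
      (indicator (f₀ x) + countIn f₀ xs) + (indicator (f₁ x) + countIn f₁ xs)
    ≡⟨ sym (cong₂ _+_ (countIn-∷ f₀ x xs) (countIn-∷ f₁ x xs)) ⟩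
      countIn f₀ (x ∷ xs) + countIn f₁ (x ∷ xs)
    ∎
    where
    open ≡-Reasoning
    rest : List (List Bool)
    rest = concatMap (λ s → (false ∷ s) ∷ (true ∷ s) ∷ []) xs

tally-zero : ∀ f → tally 0 f ≡ indicator (f [])
tally-zero f = trans (countIn-∷ f [] []) (+-identityʳ _)

tally-mono : ∀ L f g → (∀ s → f s ≡ true → g s ≡ true) → tally L f ≤ tally L g
tally-mono L f g = countIn-mono f g (strings L)

tally-const-∧ : ∀ L c g → tally L (λ s → c ∧ g s) ≡ indicator c * tally L g
tally-const-∧ L true  g = sym (+-identityʳ _)
tally-const-∧ L false g = countIn-false (strings L)

tally-true : ∀ L → tally L (λ _ → true) ≡ 2 ^ L
tally-true zero    = refl
tally-true (suc L) = trans (tally-suc L (λ _ → true))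
                           (trans (cong₂ _+_ (tally-true L) (tally-true L)) (cong (2 ^ L +_) (sym (+-identityʳ (2 ^ L)))))

tally-not : ∀ L f → tally L f + tally L (λ s → not (f s)) ≡ 2 ^ L
tally-not zero f = trans (cong₂ _+_ (tally-zero f) (tally-zero (λ s → not (f s)))) (excluded-middle (f []))
  where
  excluded-middle : ∀ b → indicator b + indicator (not b) ≡ 1
  excluded-middle true  = refl
  excluded-middle false = refl
tally-not (suc L) f = begin
    tally (suc L) f + tally (suc L) (λ s → not (f s))
  ≡⟨ cong₂ _+_ (tally-suc L f) (tally-suc L (λ s → not (f s))) ⟩
    (a + b) + (a′ + b′)
  ≡⟨ regroup a b a′ b′ ⟩
    (a + a′) + (b + b′)
  ≡⟨ cong₂ _+_ (tally-not L (λ s → f (false ∷ s))) (tally-not L (λ s → f (true ∷ s))) ⟩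
    2 ^ L + 2 ^ L
  ≡⟨ cong (2 ^ L +_) (sym (+-identityʳ (2 ^ L))) ⟩
    2 ^ suc L
  ∎
  where
  open ≡-Reasoning
  a b a′ b′ : ℕ
  a  = tally L (λ s → f (false ∷ s))
  b  = tally L (λ s → f (true ∷ s))
  a′ = tally L (λ s → not (f (false ∷ s)))
  b′ = tally L (λ s → not (f (true ∷ s)))
  regroup : ∀ a b a′ b′ → (a + b) + (a′ + b′) ≡ (a + a′) + (b + b′)
  regroup = solve-∀

tally-blocks : ∀ a b f g → tally (a + b) (λ s → f (take a s) ∧ g (drop a s)) ≡ tally a f * tally b g
tally-blocks zero    b f g = trans (tally-const-∧ b (f []) g) (cong (_* tally b g) (sym (tally-zero f)))
tally-blocks (suc a) b f g = begin
    tally (suc (a + b)) (λ s → f (take (suc a) s) ∧ g (drop (suc a) s))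
  ≡⟨ tally-suc (a + b) _ ⟩
    tally (a + b) (λ s → f (false ∷ take a s) ∧ g (drop a s)) + tally (a + b) (λ s → f (true ∷ take a s) ∧ g (drop a s))
  ≡⟨ cong₂ _+_ (tally-blocks a b (λ s → f (false ∷ s)) g) (tally-blocks a b (λ s → f (true ∷ s)) g) ⟩
    tally a (λ s → f (false ∷ s)) * tally b g + tally a (λ s → f (true ∷ s)) * tally b g
  ≡⟨ sym (*-distribʳ-+ (tally b g) (tally a (λ s → f (false ∷ s))) (tally a (λ s → f (true ∷ s)))) ⟩
    (tally a (λ s → f (false ∷ s)) + tally a (λ s → f (true ∷ s))) * tally b g
  ≡⟨ cong (_* tally b g) (sym (tally-suc a f)) ⟩
    tally (suc a) f * tally b g
  ∎
  where open ≡-Reasoning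

_==_ : Bool → Bool → Bool
false == false = true
true  == true  = true
_     == _     = false

startsWith : (d : ℕ) → (Fin d → Bool) → List Bool → Bool
startsWith zero    w s       = true
startsWith (suc d) w []      = false
startsWith (suc d) w (b ∷ s) = (b == w fz) ∧ startsWith d (λ i → w (fs i)) s

tally-startsWith : ∀ d w n → d ≤ n → tally n (startsWith d w) * 2 ^ d ≡ 2 ^ n
tally-startsWith zero    w n       _         = trans (*-identityʳ _) (tally-true n)
tally-startsWith (suc d) w (suc n) (s≤s d≤n) = begin
    tally (suc n) (startsWith (suc d) w) * (2 * 2 ^ d)
  ≡⟨ cong (_* (2 * 2 ^ d)) first-bit ⟩
    X * (2 * 2 ^ d)
  ≡⟨ reassoc X (2 ^ d) ⟩
    2 * (X * 2 ^ d)
  ≡⟨ cong (2 *_) (tally-startsWith d w′ n d≤n) ⟩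
    2 * 2 ^ n
  ∎
  where
  open ≡-Reasoning
  w′ : Fin d → Bool
  w′ i = w (fs i)
  X : ℕ
  X = tally n (startsWith d w′)
  reassoc : ∀ x p → x * (2 * p) ≡ 2 * (x * p)
  reassoc = solve-∀
  one-branch : ∀ b → indicator (false == b) * X + indicator (true == b) * X ≡ X
  one-branch false = trans (+-identityʳ _) (+-identityʳ X)
  one-branch true  = +-identityʳ X
  first-bit : tally (suc n) (startsWith (suc d) w) ≡ X
  first-bit = trans (tally-suc n (startsWith (suc d) w))
    (trans (cong₂ _+_ (tally-const-∧ n (false == w fz) (startsWith d w′))
                      (tally-const-∧ n (true == w fz) (startsWith d w′)))
           (one-branch (w fz)))

startsWith-digits : ∀ d w v → startsWith d w v ≡ true → ∀ (r : Fin d) → digit v (toℕ r) ≡ bitCode (w r)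
startsWith-digits (suc d) w (b ∷ s) e fz     = cong bitCode (==-true b (w fz) (proj₁ (∧-true e)))
  where
  ==-true : ∀ a b → (a == b) ≡ true → a ≡ b
  ==-true false false _ = refl
  ==-true true  true  _ = refl
startsWith-digits (suc d) w (b ∷ s) e (fs r) = startsWith-digits d (λ i → w (fs i)) s (proj₂ (∧-true e)) r

shift-block : ∀ n i r → n + (n * i + r) ≡ n * suc i + r
shift-block n i r = trans (sym (+-assoc n (n * i) r)) (cong (_+ r) (sym (*-suc n i)))

module Blocks (d k : ℕ) (w : Fin d → Bool) where

  blocksStartWith : ℕ → ℕ → List Bool → Bool
  blocksStartWith zero     n s = true
  blocksStartWith (suc k′) n s = startsWith d w (take n s) ∧ blocksStartWith k′ n (drop n s)

  -- The blocks are independent and each fixes d bits.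
  tally-blocksStartWith : ∀ k′ n → d ≤ n → tally (k′ * n) (blocksStartWith k′ n) * 2 ^ (k′ * d) ≡ 2 ^ (k′ * n)
  tally-blocksStartWith zero     n _   = refl
  tally-blocksStartWith (suc k′) n d≤n = begin
      tally (n + k′ * n) (blocksStartWith (suc k′) n) * 2 ^ (d + k′ * d)
    ≡⟨ cong₂ _*_ (tally-blocks n (k′ * n) (startsWith d w) (blocksStartWith k′ n)) (^-distribˡ-+-* 2 d (k′ * d)) ⟩
      (A * B) * (2 ^ d * 2 ^ (k′ * d))
    ≡⟨ regroup A B (2 ^ d) (2 ^ (k′ * d)) ⟩
      (A * 2 ^ d) * (B * 2 ^ (k′ * d))
    ≡⟨ cong₂ _*_ (tally-startsWith d w n d≤n) (tally-blocksStartWith k′ n d≤n) ⟩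
      2 ^ n * 2 ^ (k′ * n)
    ≡⟨ sym (^-distribˡ-+-* 2 n (k′ * n)) ⟩
      2 ^ (n + k′ * n)
    ∎
    where
    open ≡-Reasoning
    A B : ℕ
    A = tally n (startsWith d w)
    B = tally (k′ * n) (blocksStartWith k′ n)
    regroup : ∀ a b p q → (a * b) * (p * q) ≡ (a * p) * (b * q)
    regroup = solve-∀

  blocksStartWith-digits : ∀ k′ n u → blocksStartWith k′ n u ≡ true →
                           ∀ (i : Fin k′) (r : Fin d) → digit u (n * toℕ i + toℕ r) ≡ bitCode (w r)
  blocksStartWith-digits (suc k′) n u e fz r =
    subst (λ p → digit u (p + toℕ r) ≡ bitCode (w r)) (sym (*-zeroʳ n))
      (digit-take n u (toℕ r) (w r) (startsWith-digits d w (take n u) (proj₁ (∧-true e)) r))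
  blocksStartWith-digits (suc k′) n u e (fs i) r =
    subst (λ p → digit u p ≡ bitCode (w r)) (shift-block n (toℕ i) (toℕ r))
      (trans (sym (digit-drop n u (n * toℕ i + toℕ r)))
             (blocksStartWith-digits k′ n (drop n u) (proj₂ (∧-true {startsWith d w (take n u)} e)) i r))

  -- A single scale is missed with probability (M - 1)/M, M = 2^(k·d);
  -- we write M - 1 as M′ to stay away from truncated subtraction.
  M M′ : ℕ
  M  = 2 ^ (k * d)
  M′ = M ∸ 1

  suc-M′ : suc M′ ≡ M
  suc-M′ = m+[n∸m]≡n (m^n>0 2 (k * d))

  tally-missed : ∀ n → d ≤ n → tally (k * n) (λ s → not (blocksStartWith k n s)) * M ≡ 2 ^ (k * n) * M′
  tally-missed n d≤n = +-cancelʳ-≡ (2 ^ (k * n)) _ _ (begin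
      N * M + 2 ^ (k * n)
    ≡⟨ cong (N * M +_) (sym (tally-blocksStartWith k n d≤n)) ⟩
      N * M + Y * M
    ≡⟨ trans (+-comm (N * M) (Y * M)) (sym (*-distribʳ-+ M Y N)) ⟩
      (Y + N) * M
    ≡⟨ cong (_* M) (tally-not (k * n) (blocksStartWith k n)) ⟩
      2 ^ (k * n) * M
    ≡⟨ cong (2 ^ (k * n) *_) (sym suc-M′) ⟩
      2 ^ (k * n) * suc M′
    ≡⟨ trans (*-suc (2 ^ (k * n)) M′) (+-comm (2 ^ (k * n)) _) ⟩
      2 ^ (k * n) * M′ + 2 ^ (k * n)
    ∎)
    where
    open ≡-Reasoning
    N Y : ℕ
    N = tally (k * n) (λ s → not (blocksStartWith k n s))
    Y = tally (k * n) (blocksStartWith k n)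

  -- The scales n_j = d·(k+1)^j.  The blocks of scale j lie in
  -- [n_j , n_{j+1}), disjoint from those of every other scale.
  scale : ℕ → ℕ
  scale j = d * suc k ^ j

  scale-suc : ∀ J → scale (suc J) ≡ scale J + k * scale J
  scale-suc J = expand d k (suc k ^ J)
    where
    expand : ∀ d k p → d * ((1 + k) * p) ≡ d * p + k * (d * p)
    expand = solve-∀

  d≤scale : ∀ J → d ≤ scale J
  d≤scale J = m≤m*n d (suc k ^ J) {{m^n≢0 (suc k) J}}

  missesBelow : ℕ → List Bool → Bool
  missesBelow zero    s = true
  missesBelow (suc J) s = missesBelow J (take (scale J) s) ∧ not (blocksStartWith k (scale J) (drop (scale J) s))

  tally-missesBelow : ∀ J → tally (scale J) (missesBelow J) * M ^ J ≡ 2 ^ scale J * M′ ^ J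
  tally-missesBelow zero    = trans (*-identityʳ _) (trans (tally-true (scale 0)) (sym (*-identityʳ _)))
  tally-missesBelow (suc J) = begin
      tally (scale (suc J)) (missesBelow (suc J)) * (M * M ^ J)
    ≡⟨ cong (λ L → tally L (missesBelow (suc J)) * (M * M ^ J)) (scale-suc J) ⟩
      tally (scale J + k * scale J) (missesBelow (suc J)) * (M * M ^ J)
    ≡⟨ cong (_* (M * M ^ J)) (tally-blocks (scale J) (k * scale J) (missesBelow J) (λ s → not (blocksStartWith k (scale J) s))) ⟩
      (A * N) * (M * M ^ J)
    ≡⟨ regroup₁ A N M (M ^ J) ⟩
      (A * M ^ J) * (N * M)
    ≡⟨ cong₂ _*_ (tally-missesBelow J) (tally-missed (scale J) (d≤scale J)) ⟩
      (2 ^ scale J * M′ ^ J) * (2 ^ (k * scale J) * M′)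
    ≡⟨ regroup₂ (2 ^ scale J) (M′ ^ J) (2 ^ (k * scale J)) M′ ⟩
      (2 ^ scale J * 2 ^ (k * scale J)) * (M′ * M′ ^ J)
    ≡⟨ cong (_* (M′ * M′ ^ J)) (trans (sym (^-distribˡ-+-* 2 (scale J) (k * scale J))) (cong (2 ^_) (sym (scale-suc J)))) ⟩
      2 ^ scale (suc J) * (M′ * M′ ^ J)
    ∎
    where
    open ≡-Reasoning
    A N : ℕ
    A = tally (scale J) (missesBelow J)
    N = tally (k * scale J) (λ s → not (blocksStartWith k (scale J) s))
    regroup₁ : ∀ a n m p → (a * n) * (m * p) ≡ (a * p) * (n * m)
    regroup₁ = solve-∀
    regroup₂ : ∀ a b c e → (a * b) * (c * e) ≡ (a * c) * (e * b)
    regroup₂ = solve-∀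

bernoulli : ∀ x n → x ^ n * (x + n) ≤ suc x ^ n * x
bernoulli x zero    = ≤-reflexive (cong (1 *_) (+-identityʳ x))
bernoulli x (suc n) = begin
    x * x ^ n * (x + suc n)
  ≤⟨ m≤m+n _ (x ^ n * n) ⟩
    x * x ^ n * (x + suc n) + x ^ n * n
  ≡⟨ expand x n (x ^ n) ⟩
    suc x * (x ^ n * (x + n))
  ≤⟨ *-monoʳ-≤ (suc x) (bernoulli x n) ⟩
    suc x * (suc x ^ n * x)
  ≡⟨ sym (*-assoc (suc x) (suc x ^ n) x) ⟩
    suc x * suc x ^ n * x
  ∎
  where
  open ≤-Reasoning
  expand : ∀ x n a → x * a * (x + (1 + n)) + a * n ≡ (1 + x) * (a * (x + n))
  expand = solve-∀

doubling : ∀ x → x ^ suc x * 2 ≤ suc x ^ suc x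
doubling zero    = z≤n
doubling (suc y) = *-cancelʳ-≤ (x ^ suc x * 2) (suc x ^ suc x) x (begin
    x ^ suc x * 2 * x
  ≡⟨ double (x ^ suc x) x ⟩
    x ^ suc x * (x + x)
  ≤⟨ *-monoʳ-≤ (x ^ suc x) (+-monoʳ-≤ x (n≤1+n x)) ⟩
    x ^ suc x * (x + suc x)
  ≤⟨ bernoulli x (suc x) ⟩
    suc x ^ suc x * x
  ∎)
  where
  x : ℕ
  x = suc y
  open ≤-Reasoning
  double : ∀ a x → a * 2 * x ≡ a * (x + x)
  double = solve-∀

^-distribʳ-* : ∀ a b K → (a * b) ^ K ≡ a ^ K * b ^ K
^-distribʳ-* a b zero    = refl
^-distribʳ-* a b (suc K) = trans (cong ((a * b) *_) (^-distribʳ-* a b K)) (regroup a b (a ^ K) (b ^ K))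
  where
  regroup : ∀ a b p q → (a * b) * (p * q) ≡ (a * p) * (b * q)
  regroup = solve-∀

-- Hence (x/(x+1))^((x+1)·K) ≤ 2^(-K): the decay needed for nullity.
geometric-decay : ∀ x K → x ^ (suc x * K) * 2 ^ K ≤ suc x ^ (suc x * K)
geometric-decay x K = begin
    x ^ (suc x * K) * 2 ^ K
  ≡⟨ cong (_* 2 ^ K) (sym (^-*-assoc x (suc x) K)) ⟩
    (x ^ suc x) ^ K * 2 ^ K
  ≡⟨ sym (^-distribʳ-* (x ^ suc x) 2 K) ⟩
    (x ^ suc x * 2) ^ K
  ≤⟨ ^-monoˡ-≤ K (doubling x) ⟩
    (suc x ^ suc x) ^ K
  ≡⟨ ^-*-assoc (suc x) (suc x) K ⟩
    suc x ^ (suc x * K)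
  ∎
  where open ≤-Reasoning

n<2^n : ∀ n → n < 2 ^ n
n<2^n zero    = s≤s z≤n
n<2^n (suc n) = begin-strict
    suc n
  <⟨ s≤s (n<2^n n) ⟩
    suc (2 ^ n)
  ≤⟨ +-monoˡ-≤ (2 ^ n) (m^n>0 2 n) ⟩
    2 ^ n + 2 ^ n
  ≡⟨ cong (2 ^ n +_) (sym (+-identityʳ (2 ^ n))) ⟩
    2 ^ suc n
  ∎
  where open ≤-Reasoning

-- Agreeing with a point of P after each of the positions n·i (1 ≤ i ≤ k)
-- is k-recurrence at n, since P only reads its first depth P bits.
agreement⇒recurrentAt : ∀ P k Z n W → W ∈C P →
  (∀ i → 1 ≤ i → i ≤ k → ∀ (r : Fin (depth P)) → Z (n * i + toℕ r) ≡ W (toℕ r)) →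
  kRecurrentAt P k Z n
agreement⇒recurrentAt P k Z n W W∈P agree i 1≤i i≤k =
  trans (cong (decide P) (tabulate-cong (agree i 1≤i i≤k))) W∈P

module PatternTest (d′ k′ : ℕ) (w : Fin (suc d′) → Bool) where

  d k : ℕ
  d = suc d′
  k = suc k′

  open Blocks d k w public

  Hit : List Bool → ℕ → Set
  Hit s j = ∀ (i : Fin k) (r : Fin d) → digit s (scale j * suc (toℕ i) + toℕ r) ≡ bitCode (w r)

  scalePR : PR 2
  scalePR = lit d ⊗ comp (powPR (suc k)) (π₀ ∷ [])

  digitAtPR : ℕ → ℕ → PR 2
  digitAtPR i r = comp digitPR (scalePR ⊗ lit (suc i) ⊕ lit r ∷ π₁ ∷ [])

  eval-digitAt : ∀ i r j s → eval (digitAtPR i r) (j ∷ code s ∷ []) ≡ digit s (scale j * suc i + r)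
  eval-digitAt i r j s = trans (cong (λ p → eval digitPR (p ∷ code s ∷ [])) position)
                               (eval-digit (scale j * suc i + r) s)
    where
    xs : Vec ℕ 2
    xs = j ∷ code s ∷ []
    position : eval (scalePR ⊗ lit (suc i) ⊕ lit r) xs ≡ scale j * suc i + r
    position = begin
        eval (scalePR ⊗ lit (suc i) ⊕ lit r) xs
      ≡⟨ eval-⊕ (scalePR ⊗ lit (suc i)) (lit r) xs ⟩
        eval (scalePR ⊗ lit (suc i)) xs + eval (lit r) xs
      ≡⟨ cong₂ _+_ (eval-⊗ scalePR (lit (suc i)) xs) (eval-lit r xs) ⟩
        eval scalePR xs * eval (lit (suc i)) xs + r
      ≡⟨ cong (λ n → n * eval (lit (suc i)) xs + r)
              (trans (eval-⊗ (lit d) (comp (powPR (suc k)) (π₀ ∷ [])) xs)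
                     (cong₂ _*_ (eval-lit d xs) (eval-pow (suc k) j))) ⟩
        scale j * eval (lit (suc i)) xs + r
      ≡⟨ cong (λ n → scale j * n + r) (eval-lit (suc i) xs) ⟩
        scale j * suc i + r
      ∎
      where open ≡-Reasoning

  mismatchPR : Fin k → Fin d → PR 2
  mismatchPR i r = distPR (digitAtPR (toℕ i) (toℕ r)) (lit (bitCode (w r)))

  hitPR : PR 2
  hitPR = sumPR k (λ i → sumPR d (mismatchPR i))

  hitPR≡0⇒ : ∀ s j → eval hitPR (j ∷ code s ∷ []) ≡ 0 → Hit s j
  hitPR≡0⇒ s j e i r = trans (sym (eval-digitAt (toℕ i) (toℕ r) j s))
    (trans (dist≡0⇒ (digitAtPR (toℕ i) (toℕ r)) (lit (bitCode (w r))) xs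
                    (sum≡0⇒ d (mismatchPR i) xs (sum≡0⇒ k (λ i → sumPR d (mismatchPR i)) xs e i) r))
           (eval-lit (bitCode (w r)) xs))
    where
    xs : Vec ℕ 2
    xs = j ∷ code s ∷ []

  ⇒hitPR≡0 : ∀ s j → Hit s j → eval hitPR (j ∷ code s ∷ []) ≡ 0
  ⇒hitPR≡0 s j hit = ⇒sum≡0 k (λ i → sumPR d (mismatchPR i)) xs λ i → ⇒sum≡0 d (mismatchPR i) xs λ r →
    ⇒dist≡0 (digitAtPR (toℕ i) (toℕ r)) (lit (bitCode (w r))) xs
    (trans (eval-digitAt (toℕ i) (toℕ r) j s) (trans (hit i r) (sym (eval-lit (bitCode (w r)) xs))))
    where
    xs : Vec ℕ 2
    xs = j ∷ code s ∷ []

  -- R σ ≠ 0 iff σ shows no hit at any scale j < code σ.  The bound code σ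
  -- is harmless: a hit visible in σ lies below it (hit⇒<code).
  testPR : PR 1
  testPR = comp (prodBelowPR hitPR) (π₀ ∷ π₀ ∷ [])

  scale≥1 : ∀ j → 1 ≤ scale j
  scale≥1 j = *-mono-≤ {1} {d} (s≤s z≤n) (m^n>0 (suc k) j)

  j≤scale : ∀ j → j ≤ scale j
  j≤scale j = begin
      j
    ≤⟨ <⇒≤ (n<2^n j) ⟩
      2 ^ j
    ≤⟨ ^-monoˡ-≤ j (s≤s (s≤s z≤n)) ⟩
      suc k ^ j
    ≤⟨ m≤n*m (suc k ^ j) d ⟩
      scale j
    ∎
    where open ≤-Reasoning

  -- A visible hit at j forces σ to be longer than scale j ≥ j.
  hit⇒<code : ∀ s j → Hit s j → j < code s
  hit⇒<code s j hit = begin-strict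
      j
    ≤⟨ j≤scale j ⟩
      scale j
    ≡⟨ sym (trans (+-identityʳ _) (*-identityʳ (scale j))) ⟩
      scale j * 1 + 0
    <⟨ digit≢0⇒< s _ (λ z → bitCode≢0 (w fz) (trans (sym (hit fz fz)) z)) ⟩
      length s
    ≤⟨ length≤code s ⟩
      code s
    ∎
    where open ≤-Reasoning

  hit⇒rejected : ∀ s j → Hit s j → eval testPR (code s ∷ []) ≡ 0
  hit⇒rejected s j hit = ⇒prodBelow≡0 hitPR (code s) (code s) j (hit⇒<code s j hit) (⇒hitPR≡0 s j hit)

  rejected⇒hit : ∀ s → eval testPR (code s ∷ []) ≡ 0 → Σ ℕ (Hit s)
  rejected⇒hit s e = let (j , _ , hitPR≡0) = prodBelow≡0⇒ hitPR (code s) (code s) e in j , hitPR≡0⇒ s j hitPR≡0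

  blocks⇒hit : ∀ s j → blocksStartWith k (scale j) (drop (scale j) s) ≡ true → Hit s j
  blocks⇒hit s j e i r = subst (λ p → digit s p ≡ bitCode (w r)) (shift-block (scale j) (toℕ i) (toℕ r))
    (trans (sym (digit-drop (scale j) s (scale j * toℕ i + toℕ r)))
           (blocksStartWith-digits k (scale j) (drop (scale j) s) e i r))

  noHit⇒missesBelow : ∀ J s → (∀ j → j < J → ¬ Hit s j) → missesBelow J s ≡ true
  noHit⇒missesBelow zero    s noHit = refl
  noHit⇒missesBelow (suc J) s noHit = cong₂ _∧_
    (noHit⇒missesBelow J (take (scale J) s)
      (λ j j<J hit → noHit j (m<n⇒m<1+n j<J)
        (λ i r → digit-take (scale J) s (scale j * suc (toℕ i) + toℕ r) (w r) (hit i r))))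
    (cong not (¬-not (λ e → noHit J ≤-refl (blocks⇒hit s J e))))

  -- Strings surviving the test miss all scales: the test's class is covered
  -- by the sets counted in tally-missesBelow.
  survives⇒missesBelow : ∀ J s → survives testPR s ≡ true → missesBelow J s ≡ true
  survives⇒missesBelow J s e = noHit⇒missesBelow J s (λ j _ hit → survives⇒≢0 testPR s e (hit⇒rejected s j hit))

  -- With J = M·K scales, at most a 2^(-K) fraction of strings survive.
  test-null : Null testPR
  test-null K = scale J , (*-cancelʳ-≤ _ _ (suc M′ ^ J) {{m^n≢0 (suc M′) J}} (begin
      count testPR (scale J) * 2 ^ K * suc M′ ^ J
    ≤⟨ *-monoˡ-≤ (suc M′ ^ J) (*-monoˡ-≤ (2 ^ K) (tally-mono (scale J) _ _ (survives⇒missesBelow J))) ⟩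
      A * 2 ^ K * suc M′ ^ J
    ≡⟨ trans (*-assoc A (2 ^ K) _) (trans (cong (A *_) (*-comm (2 ^ K) _)) (sym (*-assoc A _ (2 ^ K)))) ⟩
      A * suc M′ ^ J * 2 ^ K
    ≡⟨ cong (λ m → A * m ^ J * 2 ^ K) suc-M′ ⟩
      A * M ^ J * 2 ^ K
    ≡⟨ cong (_* 2 ^ K) (tally-missesBelow J) ⟩
      2 ^ scale J * M′ ^ J * 2 ^ K
    ≡⟨ *-assoc (2 ^ scale J) (M′ ^ J) (2 ^ K) ⟩
      2 ^ scale J * (M′ ^ J * 2 ^ K)
    ≤⟨ *-monoʳ-≤ (2 ^ scale J) (geometric-decay M′ K) ⟩
      2 ^ scale J * suc M′ ^ J
    ∎))
    where
    open ≤-Reasoning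
    J A : ℕ
    J = suc M′ * K
    A = tally (scale J) (missesBelow J)

  hit⇒agreement : ∀ Z m j → Hit (prefix Z m) j →
    ∀ i → 1 ≤ i → i ≤ k → ∀ (r : Fin d) → Z (scale j * i + toℕ r) ≡ w r
  hit⇒agreement Z m j hit (suc i) _ i<k r =
    subst (λ i′ → Z (scale j * suc i′ + toℕ r) ≡ w r) (toℕ-fromℕ< i<k)
      (digit-prefix Z m _ (w r) (hit (fromℕ< i<k) r))

mainTheorem3 : (P : Clopen) → NonEmpty P → (Z : Seq) → KurtzRandom Z → MultiplyRecurrent P Z
mainTheorem3 P@record { depth = zero } (W , W∈P) Z _ k _ =
  1 , s≤s z≤n , agreement⇒recurrentAt P k Z 1 W W∈P (λ _ _ _ ())
mainTheorem3 P@record { depth = suc d′ } (W , W∈P) Z random (suc k′) _ =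
  scale j , scale≥1 j , agreement⇒recurrentAt P (suc k′) Z (scale j) W W∈P (hit⇒agreement Z m j hit)
  where
  open PatternTest d′ k′ (λ r → W (toℕ r))
  exit : NotIn Z testPR
  exit = random testPR test-null
  m : ℕ
  m = proj₁ exit
  hitAt : Σ ℕ (Hit (prefix Z m))
  hitAt = rejected⇒hit (prefix Z m) (proj₂ exit)
  j : ℕ
  j = proj₁ hitAt
  hit : Hit (prefix Z m) j
  hit = proj₂ hitAt
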